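{- Let $G$ be a prime graph that contains a graph $H$ on at least $3$ vertices as an induced subgraph. Let $x,x'\in V(H)$ be true twins or false twins in $H$. Then $G$ contains an induced subgraph $H'$ that is isomorphic to $H$ via an isomorphism $\varphi$, together with a vertex $v\in V(G)\setminus V(H')$ that is adjacent to exactly one vertex of $\{\varphi(x),\varphi(x')\}$, such that $\{\varphi(x),\varphi(x'),v\}$ is not a homogeneous set of $G[V(H')\cup\{v\}]$.
   Context: All graphs are finite, simple (loopless) and undirected. $N_G(v)$ denotes the open neighborhood of $v$ in $G$. $\overline{N}_G(v)=N_G(v)\cup\{v\}$ denotes the closed neighborhood. $G[M]$ denotes the subgraph of $G$ induced by $M$. A homogeneous set of a graph $G$ is a set $M\subseteq V(G)$ with $2\le |M|<|V(G)|$ such that $N_G(y)\setminus M=N_G(y')\setminus M$ for all $y,y'\in M$. A graph is prime if it has no homogeneous set. Two distinct vertices $x,x'$ are true twins if $N_G(x)=N_G(x')$, and false twins if $\overline{N}_G(x)=\overline{N}_G(x')$. -}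

module Defs where

open import Data.Nat using (ℕ; _≤_; _<_)
open import Data.Bool using (Bool; true; false)
open import Data.Fin using (Fin; _≟_)
open import Data.Fin.Subset using (Subset; _∈_; _∉_; _⊆_; ∣_∣; ⁅_⁆; _∪_; ⊤)
open import Data.Fin.Properties using (any?)
open import Data.Vec using (tabulate)
open import Data.Product using (Σ; _×_; ∃)
open import Relation.Nullary using (¬_; does)
open import Relation.Binary.PropositionalEquality using (_≡_; _≢_)
open import Function.Definitions using (Injective)

record Graph : Set where
  field
    n     : ℕ
    adj   : Fin n → Fin n → Bool
    sym   : ∀ u v → adj u v ≡ adj v u
    loopless : ∀ v → adj v v ≡ false
open Graph public

V : Graph → Set
V G = Fin (n G)

N : (G : Graph) → V G → Subset (n G)
N G v = tabulate (λ u → adj G v u)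

Nbar : (G : Graph) → V G → Subset (n G)
Nbar G v = N G v ∪ ⁅ v ⁆

-- M is a homogeneous set of the induced subgraph G[S] (requires M ⊆ S):
-- 2 ≤ |M| < |S| and every vertex of S outside M sees all of M or none of M,
-- i.e. N_{G[S]}(y) \ M = N_{G[S]}(y') \ M for y, y' ∈ M.
HomogeneousIn : (G : Graph) → Subset (n G) → Subset (n G) → Set
HomogeneousIn G S M =
  M ⊆ S × 2 ≤ ∣ M ∣ × ∣ M ∣ < ∣ S ∣ ×
  (∀ y y' z → y ∈ M → y' ∈ M → z ∈ S → z ∉ M → adj G y z ≡ adj G y' z)

Homogeneous : (G : Graph) → Subset (n G) → Set
Homogeneous G M = HomogeneousIn G ⊤ M

Prime : Graph → Set
Prime G = ∀ M → ¬ Homogeneous G M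

TrueTwins : (G : Graph) → V G → V G → Set
TrueTwins G x x' = x ≢ x' × N G x ≡ N G x'

FalseTwins : (G : Graph) → V G → V G → Set
FalseTwins G x x' = x ≢ x' × Nbar G x ≡ Nbar G x'

-- An induced embedding of H into G: an injective map preserving adjacency and
-- non-adjacency. Its image induces a subgraph H' of G isomorphic to H via φ.
IsInducedEmbedding : (H G : Graph) → (V H → V G) → Set
IsInducedEmbedding H G φ = Injective _≡_ _≡_ φ × (∀ i j → adj G (φ i) (φ j) ≡ adj H i j)

ContainsInduced : Graph → Graph → Set
ContainsInduced G H = Σ (V H → V G) (IsInducedEmbedding H G)

image : (H G : Graph) → (V H → V G) → Subset (n G)
image H G φ = tabulate (λ u → does (any? (λ i → φ i ≟ u)))

-- Call a vertex u of G a substitute for φ x if, like φ x and φ x', it lies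
-- outside T = φ (V H ∖ {x, x'}) and sees every vertex φ w of T exactly as x sees
-- w in H; any two distinct substitutes a, b with adj a b = adj x x' may replace
-- φ x, φ x'. Starting from the set of all substitutes, shrink a set K of
-- substitutes containing φ x and φ x' while keeping it closed: no member of K
-- is joined to a substitute outside K in the way φ x is joined to φ x'. As G is
-- prime, K has a splitter z; closedness forces z to be a non-substitute, and z
-- is outside T since all of K sees T alike. Either z separates some a, b ∈ K
-- joined like φ x, φ x' – then a, b, z give the required H' and v – or the part
-- of K that z sees like φ x is a smaller closed set.
module Submission where

open import Defs hiding (sym)
open import Data.Nat using (_≤_; _<_; s≤s)
open import Data.Nat.Induction using (<-wellFounded)
open import Data.Bool using (Bool; false; _∨_)
open import Data.Bool.Properties using (¬-not; ∨-identityʳ) renaming (_≟_ to _≟ᵇ_)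
open import Data.Fin using (Fin; zero; suc; _≟_)
open import Data.Fin.Subset using (Subset; _∈_; _∉_; _⊆_; ∣_∣; ⁅_⁆; _∪_; ⊤)
open import Data.Fin.Subset.Properties
  using (_∈?_; ∈⊤; ⊆⊤; ∣⁅x⁆∣≡1; x∈⁅x⁆; x∈⁅y⁆⇒x≡y; x≢y⇒x∉⁅y⁆; x∈p∪q⁻; x∈p∪q⁺; p⊂q⇒∣p∣<∣q∣)
open import Data.Fin.Properties using (any?; all?; ¬∀⟶∃¬)
open import Data.Vec using (tabulate; lookup)
open import Data.Vec.Properties using (lookup∘tabulate; lookup-zipWith; []=⇒lookup; lookup⇒[]=)
open import Data.Product using (Σ; _×_; ∃; ∃₂; _,_; proj₁; proj₂)
open import Data.Sum using (_⊎_; inj₁; inj₂)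
open import Data.Empty using (⊥-elim)
open import Function using (_∘_)
open import Function.Definitions using (Injective)
open import Induction.WellFounded using (Acc; acc)
open import Level using (0ℓ)
open import Relation.Nullary using (¬_; Dec; yes; no; does)
open import Relation.Nullary.Decidable using (_×-dec_; _→-dec_; ¬?; dec-true; decidable-stable)
open import Relation.Unary using (Pred; Decidable)
open import Relation.Binary.PropositionalEquality
  using (_≡_; _≢_; refl; sym; trans; cong; cong₂; subst; module ≡-Reasoning)

module _ {m} {P : Pred (Fin m) 0ℓ} (P? : Decidable P) where

  ∈-tabulate⁺ : ∀ {u} → P u → u ∈ tabulate (does ∘ P?)
  ∈-tabulate⁺ {u} p = lookup⇒[]= u _ (trans (lookup∘tabulate (does ∘ P?) u) (dec-true (P? u) p))

  ∈-tabulate⁻ : ∀ {u} → u ∈ tabulate (does ∘ P?) → P u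
  ∈-tabulate⁻ {u} u∈ with P? u | trans (sym (lookup∘tabulate (does ∘ P?) u)) ([]=⇒lookup u∈)
  ... | yes p | _ = p
  ... | no _  | ()

∈-image⁺ : (H G : Graph) (f : V H → V G) (i : V H) → f i ∈ image H G f
∈-image⁺ H G f i = ∈-tabulate⁺ (λ u → any? λ j → f j ≟ u) (i , refl)

∈-image⁻ : (H G : Graph) (f : V H → V G) {u : V G} → u ∈ image H G f → ∃ λ i → f i ≡ u
∈-image⁻ H G f = ∈-tabulate⁻ (λ u → any? λ j → f j ≟ u)

≢-both⇒≡ : {a b e : Bool} → a ≢ e → b ≢ e → a ≡ b
≢-both⇒≡ a≢e b≢e = trans (¬-not a≢e) (sym (¬-not b≢e))

∃-≢₂ : ∀ {m} → 3 ≤ m → (i j : Fin m) → ∃ λ k → k ≢ i × k ≢ j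
∃-≢₂ (s≤s (s≤s (s≤s _))) i j with zero ≟ i | zero ≟ j | suc zero ≟ i | suc zero ≟ j
... | no 0≢i | no 0≢j | _        | _        = zero , 0≢i , 0≢j
... | _      | _      | no 1≢i   | no 1≢j   = suc zero , 1≢i , 1≢j
... | yes refl | _    | _        | yes refl = suc (suc zero) , (λ ()) , (λ ())
... | _    | yes refl | yes refl | _        = suc (suc zero) , (λ ()) , (λ ())
... | yes refl | _    | yes ()   | _
... | _    | yes refl | _        | yes ()

lookup-N : (G : Graph) (v w : V G) → lookup (N G v) w ≡ adj G v w
lookup-N G v = lookup∘tabulate (adj G v)

lookup-Nbar : (G : Graph) {v w : V G} → w ≢ v → lookup (Nbar G v) w ≡ adj G v w
lookup-Nbar G {v} {w} w≢v = begin
  lookup (N G v ∪ ⁅ v ⁆) w           ≡⟨ lookup-zipWith _∨_ w (N G v) ⁅ v ⁆ ⟩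
  lookup (N G v) w ∨ lookup ⁅ v ⁆ w  ≡⟨ cong₂ _∨_ (lookup-N G v w) w∉⁅v⁆ ⟩
  adj G v w ∨ false                  ≡⟨ ∨-identityʳ (adj G v w) ⟩
  adj G v w                          ∎
  where
  open ≡-Reasoning
  w∉⁅v⁆ : lookup ⁅ v ⁆ w ≡ false
  w∉⁅v⁆ = ¬-not (x≢y⇒x∉⁅y⁆ w≢v ∘ lookup⇒[]= w ⁅ v ⁆)

twins⇒adj≡ : (H : Graph) {x x' : V H} → TrueTwins H x x' ⊎ FalseTwins H x x' →
             ∀ w → w ≢ x → w ≢ x' → adj H x w ≡ adj H x' w
twins⇒adj≡ H {x} {x'} (inj₁ (_ , Nx≡Nx')) w _ _ = begin
  adj H x w          ≡⟨ sym (lookup-N H x w) ⟩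
  lookup (N H x) w   ≡⟨ cong (λ s → lookup s w) Nx≡Nx' ⟩
  lookup (N H x') w  ≡⟨ lookup-N H x' w ⟩
  adj H x' w         ∎
  where open ≡-Reasoning
twins⇒adj≡ H {x} {x'} (inj₂ (_ , N̄x≡N̄x')) w w≢x w≢x' = begin
  adj H x w             ≡⟨ sym (lookup-Nbar H w≢x) ⟩
  lookup (Nbar H x) w   ≡⟨ cong (λ s → lookup s w) N̄x≡N̄x' ⟩
  lookup (Nbar H x') w  ≡⟨ lookup-Nbar H w≢x' ⟩
  adj H x' w            ∎
  where open ≡-Reasoning

twins⇒≢ : (H : Graph) {x x' : V H} → TrueTwins H x x' ⊎ FalseTwins H x x' → x ≢ x'
twins⇒≢ H (inj₁ (x≢x' , _)) = x≢x'
twins⇒≢ H (inj₂ (x≢x' , _)) = x≢x'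

Splitter : (G : Graph) → Subset (n G) → V G → Set
Splitter G K z = z ∉ K × ∃₂ λ y y' → y ∈ K × y' ∈ K × adj G y z ≢ adj G y' z

splitter⇒¬homogeneousIn : (G : Graph) {S K : Subset (n G)} {z : V G} →
  z ∈ S → Splitter G K z → ¬ HomogeneousIn G S K
splitter⇒¬homogeneousIn G z∈S (z∉K , y , y' , y∈K , y'∈K , splits) (_ , _ , _ , uniform) =
  splits (uniform y y' _ y∈K y'∈K z∈S z∉K)

splitter? : (G : Graph) (K : Subset (n G)) → Decidable (Splitter G K)
splitter? G K z = ¬? (z ∈? K) ×-dec any? λ y → any? λ y' →
  (y ∈? K) ×-dec (y' ∈? K) ×-dec ¬? (adj G y z ≟ᵇ adj G y' z)

prime⇒splitter : (G : Graph) → Prime G → {K : Subset (n G)} {y y' u : V G} →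
  y ∈ K → y' ∈ K → y ≢ y' → u ∉ K → ∃ (Splitter G K)
prime⇒splitter G prime {K} {y} {y'} {u} y∈K y'∈K y≢y' u∉K with any? (splitter? G K)
... | yes found = found
... | no none = ⊥-elim (prime K (⊆⊤ , 2≤∣K∣ , ∣K∣<n , uniform))
  where
  2≤∣K∣ : 2 ≤ ∣ K ∣
  2≤∣K∣ = subst (_< ∣ K ∣) (∣⁅x⁆∣≡1 y)
    (p⊂q⇒∣p∣<∣q∣ ((λ v∈ → subst (_∈ K) (sym (x∈⁅y⁆⇒x≡y y v∈)) y∈K) ,
                  y' , y'∈K , y≢y' ∘ sym ∘ x∈⁅y⁆⇒x≡y y))
  ∣K∣<n : ∣ K ∣ < ∣ ⊤ {n G} ∣
  ∣K∣<n = p⊂q⇒∣p∣<∣q∣ (⊆⊤ , u , ∈⊤ , u∉K)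
  uniform : ∀ v v' z → v ∈ K → v' ∈ K → z ∈ ⊤ → z ∉ K → adj G v z ≡ adj G v' z
  uniform v v' z v∈K v'∈K _ z∉K = decidable-stable (adj G v z ≟ᵇ adj G v' z)
    λ splits → none (z , z∉K , v , v' , v∈K , v'∈K , splits)

module Substitution
  (G H : Graph) (φ : V H → V G)
  (φ-injective : Injective _≡_ _≡_ φ) (φ-adj : ∀ i j → adj G (φ i) (φ j) ≡ adj H i j)
  (x x' : V H) (x≢x' : x ≢ x') (x~x' : ∀ w → w ≢ x → w ≢ x' → adj H x w ≡ adj H x' w)
  where

  SubstituteAt : V G → V H → Set
  SubstituteAt u w = w ≢ x → w ≢ x' → u ≢ φ w × adj G u (φ w) ≡ adj H x w

  Substitute : V G → Set
  Substitute u = ∀ w → SubstituteAt u w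

  substituteAt? : ∀ u w → Dec (SubstituteAt u w)
  substituteAt? u w = ¬? (w ≟ x) →-dec ¬? (w ≟ x') →-dec
    ¬? (u ≟ φ w) ×-dec (adj G u (φ w) ≟ᵇ adj H x w)

  substitute? : ∀ u → Dec (Substitute u)
  substitute? u = all? (substituteAt? u)

  substitute-φx : Substitute (φ x)
  substitute-φx w w≢x _ = w≢x ∘ sym ∘ φ-injective , φ-adj x w

  substitute-φx' : Substitute (φ x')
  substitute-φx' w w≢x w≢x' = w≢x' ∘ sym ∘ φ-injective , trans (φ-adj x' w) (sym (x~x' w w≢x w≢x'))

  φ-¬substitute : ∀ w → w ≢ x → w ≢ x' → ¬ Substitute (φ w)
  φ-¬substitute w w≢x w≢x' sub = proj₁ (sub w w≢x w≢x') refl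

  ¬substitute⇒witness : ∀ {z} → ¬ Substitute z → (∀ w → w ≢ x → w ≢ x' → z ≢ φ w) →
    ∃ λ w → w ≢ x × w ≢ x' × adj G z (φ w) ≢ adj H x w
  ¬substitute⇒witness {z} ¬sub z∉T with ¬∀⟶∃¬ (n H) (SubstituteAt z) (substituteAt? z) ¬sub
  ... | w , ¬subAt with w ≟ x | w ≟ x'
  ...   | yes w≡x | _        = ⊥-elim (¬subAt λ w≢x _ → ⊥-elim (w≢x w≡x))
  ...   | no _    | yes w≡x' = ⊥-elim (¬subAt λ _ w≢x' → ⊥-elim (w≢x' w≡x'))
  ...   | no w≢x  | no w≢x'  = w , w≢x , w≢x' , λ z~w → ¬subAt λ _ _ → z∉T w w≢x w≢x' , z~w

  module Rerouted (a b : V G) (a-sub : Substitute a) (b-sub : Substitute b)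
    (a≢b : a ≢ b) (a~b : adj G a b ≡ adj H x x') where

    ψ : V H → V G
    ψ i with i ≟ x | i ≟ x'
    ... | yes _ | _     = a
    ... | no _  | yes _ = b
    ... | no _  | no _  = φ i

    data View (i : V H) : V G → Set where
      at-x  : i ≡ x → View i a
      at-x' : i ≡ x' → View i b
      other : i ≢ x → i ≢ x' → View i (φ i)

    view : ∀ i → View i (ψ i)
    view i with i ≟ x | i ≟ x'
    ... | yes i≡x | _        = at-x i≡x
    ... | no _    | yes i≡x' = at-x' i≡x'
    ... | no i≢x  | no i≢x'  = other i≢x i≢x'

    ψ-x : ψ x ≡ a
    ψ-x with ψ x | view x
    ... | _ | at-x _         = refl
    ... | _ | at-x' x≡x'     = ⊥-elim (x≢x' x≡x')
    ... | _ | other x≢x _    = ⊥-elim (x≢x refl)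

    ψ-x' : ψ x' ≡ b
    ψ-x' with ψ x' | view x'
    ... | _ | at-x x'≡x      = ⊥-elim (x≢x' (sym x'≡x))
    ... | _ | at-x' _        = refl
    ... | _ | other _ x'≢x'  = ⊥-elim (x'≢x' refl)

    ψ-other : ∀ {w} → w ≢ x → w ≢ x' → ψ w ≡ φ w
    ψ-other {w} w≢x w≢x' with ψ w | view w
    ... | _ | at-x w≡x       = ⊥-elim (w≢x w≡x)
    ... | _ | at-x' w≡x'     = ⊥-elim (w≢x' w≡x')
    ... | _ | other _ _      = refl

    a~φ : ∀ {j} → j ≢ x → j ≢ x' → adj G a (φ j) ≡ adj H x j
    a~φ j≢x j≢x' = proj₂ (a-sub _ j≢x j≢x')

    b~φ : ∀ {j} → j ≢ x → j ≢ x' → adj G b (φ j) ≡ adj H x' j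
    b~φ j≢x j≢x' = trans (proj₂ (b-sub _ j≢x j≢x')) (x~x' _ j≢x j≢x')

    φ~a : ∀ {i} → i ≢ x → i ≢ x' → adj G (φ i) a ≡ adj H i x
    φ~a {i} i≢x i≢x' = trans (Graph.sym G (φ i) a) (trans (a~φ i≢x i≢x') (Graph.sym H x i))

    φ~b : ∀ {i} → i ≢ x → i ≢ x' → adj G (φ i) b ≡ adj H i x'
    φ~b {i} i≢x i≢x' = trans (Graph.sym G (φ i) b) (trans (b~φ i≢x i≢x') (Graph.sym H x' i))

    ψ-adj : ∀ i j → adj G (ψ i) (ψ j) ≡ adj H i j
    ψ-adj i j with ψ i | view i | ψ j | view j
    ... | _ | at-x refl  | _ | at-x refl  = trans (loopless G a) (sym (loopless H x))
    ... | _ | at-x refl  | _ | at-x' refl = a~b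
    ... | _ | at-x refl  | _ | other j≢x j≢x' = a~φ j≢x j≢x'
    ... | _ | at-x' refl | _ | at-x refl  = trans (Graph.sym G b a) (trans a~b (Graph.sym H x x'))
    ... | _ | at-x' refl | _ | at-x' refl = trans (loopless G b) (sym (loopless H x'))
    ... | _ | at-x' refl | _ | other j≢x j≢x' = b~φ j≢x j≢x'
    ... | _ | other i≢x i≢x' | _ | at-x refl  = φ~a i≢x i≢x'
    ... | _ | other i≢x i≢x' | _ | at-x' refl = φ~b i≢x i≢x'
    ... | _ | other _ _  | _ | other _ _  = φ-adj i j

    ψ-injective : Injective _≡_ _≡_ ψ
    ψ-injective {i} {j} eq with ψ i | view i | ψ j | view j
    ... | _ | at-x refl  | _ | at-x refl  = refl
    ... | _ | at-x refl  | _ | at-x' refl = ⊥-elim (a≢b eq)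
    ... | _ | at-x refl  | _ | other j≢x j≢x' = ⊥-elim (proj₁ (a-sub j j≢x j≢x') eq)
    ... | _ | at-x' refl | _ | at-x refl  = ⊥-elim (a≢b (sym eq))
    ... | _ | at-x' refl | _ | at-x' refl = refl
    ... | _ | at-x' refl | _ | other j≢x j≢x' = ⊥-elim (proj₁ (b-sub j j≢x j≢x') eq)
    ... | _ | other i≢x i≢x' | _ | at-x refl  = ⊥-elim (proj₁ (a-sub i i≢x i≢x') (sym eq))
    ... | _ | other i≢x i≢x' | _ | at-x' refl = ⊥-elim (proj₁ (b-sub i i≢x i≢x') (sym eq))
    ... | _ | other _ _  | _ | other _ _  = φ-injective eq

    module _ {z : V G} (z≢a : z ≢ a) (z≢b : z ≢ b) (z∉T : ∀ w → w ≢ x → w ≢ x' → z ≢ φ w) where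

      z∉image : z ∉ image H G ψ
      z∉image z∈ with ∈-image⁻ H G ψ z∈
      ... | i , ψi≡z with ψ i | view i
      ...   | _ | at-x _          = z≢a (sym ψi≡z)
      ...   | _ | at-x' _         = z≢b (sym ψi≡z)
      ...   | _ | other i≢x i≢x'  = z∉T i i≢x i≢x' (sym ψi≡z)

      z-witness : adj G a z ≢ adj G b z →
        ∀ {w} → w ≢ x → w ≢ x' → adj G z (φ w) ≢ adj H x w →
        z ∉ image H G ψ × adj G z (ψ x) ≢ adj G z (ψ x') ×
        ¬ HomogeneousIn G (image H G ψ ∪ ⁅ z ⁆) (⁅ ψ x ⁆ ∪ ⁅ ψ x' ⁆ ∪ ⁅ z ⁆)
      z-witness a≁b {w} w≢x w≢x' z≁w =
        z∉image ,
        z≁ψx,ψx' ,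
        splitter⇒¬homogeneousIn G (x∈p∪q⁺ (inj₁ (∈-image⁺ H G ψ w)))
          (ψw∉M , ψ x , z , x∈p∪q⁺ (inj₁ (x∈⁅x⁆ (ψ x))) , x∈p∪q⁺ (inj₂ (x∈p∪q⁺ (inj₂ (x∈⁅x⁆ z)))) ,
           ψx≁ψw)
        where
        ψw∉M : ψ w ∉ ⁅ ψ x ⁆ ∪ ⁅ ψ x' ⁆ ∪ ⁅ z ⁆
        ψw∉M ψw∈ with x∈p∪q⁻ ⁅ ψ x ⁆ _ ψw∈
        ... | inj₁ ψw∈⁅ψx⁆ = w≢x (ψ-injective (x∈⁅y⁆⇒x≡y _ ψw∈⁅ψx⁆))
        ... | inj₂ ψw∈⁅ψx'⁆∪⁅z⁆ with x∈p∪q⁻ ⁅ ψ x' ⁆ _ ψw∈⁅ψx'⁆∪⁅z⁆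
        ...   | inj₁ ψw∈⁅ψx'⁆ = w≢x' (ψ-injective (x∈⁅y⁆⇒x≡y _ ψw∈⁅ψx'⁆))
        ...   | inj₂ ψw∈⁅z⁆ = z∉image (subst (_∈ image H G ψ) (x∈⁅y⁆⇒x≡y _ ψw∈⁅z⁆) (∈-image⁺ H G ψ w))
        ψx≁ψw : adj G (ψ x) (ψ w) ≢ adj G z (ψ w)
        ψx≁ψw eq = z≁w (begin
          adj G z (φ w)      ≡⟨ cong (adj G z) (sym (ψ-other w≢x w≢x')) ⟩
          adj G z (ψ w)      ≡⟨ sym eq ⟩
          adj G (ψ x) (ψ w)  ≡⟨ ψ-adj x w ⟩
          adj H x w          ∎)
          where open ≡-Reasoning
        z≁ψx,ψx' : adj G z (ψ x) ≢ adj G z (ψ x')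
        z≁ψx,ψx' eq = a≁b (begin
          adj G a z       ≡⟨ Graph.sym G a z ⟩
          adj G z a       ≡⟨ cong (adj G z) (sym ψ-x) ⟩
          adj G z (ψ x)   ≡⟨ eq ⟩
          adj G z (ψ x')  ≡⟨ cong (adj G z) ψ-x' ⟩
          adj G z b       ≡⟨ Graph.sym G z b ⟩
          adj G b z       ∎)
          where open ≡-Reasoning

  record Closed (K : Subset (n G)) : Set where
    field
      substitutes : ∀ {u} → u ∈ K → Substitute u
      φx∈K        : φ x ∈ K
      φx'∈K       : φ x' ∈ K
      closed      : ∀ {a b} → a ∈ K → Substitute b → b ∉ K → adj G a b ≢ adj H x x'

  substitutes-closed : Closed (tabulate (does ∘ substitute?))
  substitutes-closed = record
    { substitutes = ∈-tabulate⁻ substitute?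
    ; φx∈K        = ∈-tabulate⁺ substitute? substitute-φx
    ; φx'∈K       = ∈-tabulate⁺ substitute? substitute-φx'
    ; closed      = λ _ b-sub b∉K _ → b∉K (∈-tabulate⁺ substitute? b-sub)
    }

  record Certificate : Set where
    field
      a b z     : V G
      a-sub     : Substitute a
      b-sub     : Substitute b
      a~b       : adj G a b ≡ adj H x x'
      z≢a       : z ≢ a
      z≢b       : z ≢ b
      z∉T       : ∀ w → w ≢ x → w ≢ x' → z ≢ φ w
      ¬z-sub    : ¬ Substitute z
      z-splits  : adj G a z ≢ adj G b z

  Rerouting : Set
  Rerouting = Σ (V H → V G) λ ψ → IsInducedEmbedding H G ψ × Σ (V G) λ v →
    v ∉ image H G ψ × adj G v (ψ x) ≢ adj G v (ψ x') ×
    ¬ HomogeneousIn G (image H G ψ ∪ ⁅ v ⁆) (⁅ ψ x ⁆ ∪ ⁅ ψ x' ⁆ ∪ ⁅ v ⁆)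

  module _ (c : Certificate) where
    open Certificate c
    open Rerouted a b a-sub b-sub (z-splits ∘ cong (λ u → adj G u z)) a~b

    certificate⇒rerouting : Rerouting
    certificate⇒rerouting with ¬substitute⇒witness ¬z-sub z∉T
    ... | w , w≢x , w≢x' , z≁φw =
      ψ , (ψ-injective , ψ-adj) , z , z-witness z≢a z≢b z∉T z-splits w≢x w≢x' z≁φw

  Separated : Subset (n G) → V G → Set
  Separated K z = ∃₂ λ a b → a ∈ K × b ∈ K × adj G a z ≢ adj G b z × adj G a b ≡ adj H x x'

  separated? : ∀ K z → Dec (Separated K z)
  separated? K z = any? λ a → any? λ b →
    (a ∈? K) ×-dec (b ∈? K) ×-dec ¬? (adj G a z ≟ᵇ adj G b z) ×-dec (adj G a b ≟ᵇ adj H x x')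

  module _ {K : Subset (n G)} (K-closed : Closed K) where
    open Closed K-closed

    splitter-∉T : ∀ {z} → Splitter G K z → ∀ w → w ≢ x → w ≢ x' → z ≢ φ w
    splitter-∉T (_ , y , y' , y∈K , y'∈K , y≁y') w w≢x w≢x' refl =
      y≁y' (trans (proj₂ (substitutes y∈K w w≢x w≢x')) (sym (proj₂ (substitutes y'∈K w w≢x w≢x'))))

    splitter-¬substitute : ∀ {z} → Splitter G K z → ¬ Substitute z
    splitter-¬substitute (z∉K , y , y' , y∈K , y'∈K , y≁y') z-sub =
      y≁y' (≢-both⇒≡ (closed y∈K z-sub z∉K) (closed y'∈K z-sub z∉K))

    separated⇒certificate : ∀ {z} → Splitter G K z → Separated K z → Certificate
    separated⇒certificate {z} z-splitter@(z∉K , _) (a , b , a∈K , b∈K , z-splits , a~b) = record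
      { a = a ; b = b ; z = z
      ; a-sub = substitutes a∈K ; b-sub = substitutes b∈K
      ; a~b = a~b
      ; z≢a = λ z≡a → z∉K (subst (_∈ K) (sym z≡a) a∈K)
      ; z≢b = λ z≡b → z∉K (subst (_∈ K) (sym z≡b) b∈K)
      ; z∉T = splitter-∉T z-splitter
      ; ¬z-sub = splitter-¬substitute z-splitter
      ; z-splits = z-splits
      }

    shrink : ∀ {z} → Splitter G K z → ¬ Separated K z → ∃ λ K' → Closed K' × ∣ K' ∣ < ∣ K ∣
    shrink {z} (z∉K , y , y' , y∈K , y'∈K , y≁y') unseparated = K' , K'-closed , ∣K'∣<∣K∣
      where
      LikeφxAt : V G → Set
      LikeφxAt u = u ∈ K × adj G u z ≡ adj G (φ x) z

      likeφxAt? : Decidable LikeφxAt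
      likeφxAt? u = (u ∈? K) ×-dec (adj G u z ≟ᵇ adj G (φ x) z)

      K' : Subset (n G)
      K' = tabulate (does ∘ likeφxAt?)

      K'⊆K : K' ⊆ K
      K'⊆K = proj₁ ∘ ∈-tabulate⁻ likeφxAt?

      ~z : ∀ {u} → u ∈ K' → adj G u z ≡ adj G (φ x) z
      ~z = proj₂ ∘ ∈-tabulate⁻ likeφxAt?

      φx'∈K' : φ x' ∈ K'
      φx'∈K' = ∈-tabulate⁺ likeφxAt? (φx'∈K , decidable-stable (_ ≟ᵇ _) λ φx'≁φx →
        unseparated (φ x , φ x' , φx∈K , φx'∈K , φx'≁φx ∘ sym , φ-adj x x'))

      K'-closed : Closed K'
      K'-closed = record
        { substitutes = substitutes ∘ K'⊆K
        ; φx∈K        = ∈-tabulate⁺ likeφxAt? (φx∈K , refl)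
        ; φx'∈K       = φx'∈K'
        ; closed      = closed'
        }
        where
        closed' : ∀ {a b} → a ∈ K' → Substitute b → b ∉ K' → adj G a b ≢ adj H x x'
        closed' {a} {b} a∈K' b-sub b∉K' with b ∈? K
        ... | no b∉K  = closed (K'⊆K a∈K') b-sub b∉K
        ... | yes b∈K = λ a~b → unseparated (a , b , K'⊆K a∈K' , b∈K , a≁b , a~b)
          where
          a≁b : adj G a z ≢ adj G b z
          a≁b a≈b = b∉K' (∈-tabulate⁺ likeφxAt? (b∈K , trans (sym a≈b) (~z a∈K')))

      ∣K'∣<∣K∣ : ∣ K' ∣ < ∣ K ∣
      ∣K'∣<∣K∣ = p⊂q⇒∣p∣<∣q∣ (K'⊆K , dropped)
        where
        dropped : ∃ λ u → u ∈ K × u ∉ K'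
        dropped with y ∈? K'
        ... | no y∉K'  = y , y∈K , y∉K'
        ... | yes y∈K' = y' , y'∈K , λ y'∈K' → y≁y' (trans (~z y∈K') (sym (~z y'∈K')))

  module _ (prime : Prime G) {w₀ : V H} (w₀≢x : w₀ ≢ x) (w₀≢x' : w₀ ≢ x') where

    closed⇒splitter : ∀ {K} → Closed K → ∃ (Splitter G K)
    closed⇒splitter K-closed =
      prime⇒splitter G prime φx∈K φx'∈K (x≢x' ∘ φ-injective) (φ-¬substitute w₀ w₀≢x w₀≢x' ∘ substitutes)
      where open Closed K-closed

    step : ∀ {K} → Closed K → Certificate ⊎ ∃ λ K' → Closed K' × ∣ K' ∣ < ∣ K ∣
    step {K} K-closed with closed⇒splitter K-closed
    ... | z , z-splitter with separated? K z
    ...   | yes separated = inj₁ (separated⇒certificate K-closed z-splitter separated)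
    ...   | no unseparated = inj₂ (shrink K-closed z-splitter unseparated)

    descend : ∀ {K} → Acc _<_ ∣ K ∣ → Closed K → Certificate
    descend (acc smaller) K-closed with step K-closed
    ... | inj₁ found = found
    ... | inj₂ (_ , K'-closed , ∣K'∣<∣K∣) = descend (smaller ∣K'∣<∣K∣) K'-closed

    rerouting : Rerouting
    rerouting = certificate⇒rerouting (descend (<-wellFounded _) substitutes-closed)

lemma4 : (G H : Graph) → Prime G → 3 ≤ n H → ContainsInduced G H →
    (x x' : V H) → TrueTwins H x x' ⊎ FalseTwins H x x' →
    Σ (V H → V G) λ φ → IsInducedEmbedding H G φ × Σ (V G) λ v →
      v ∉ image H G φ × adj G v (φ x) ≢ adj G v (φ x') ×
      ¬ HomogeneousIn G (image H G φ ∪ ⁅ v ⁆) (⁅ φ x ⁆ ∪ ⁅ φ x' ⁆ ∪ ⁅ v ⁆)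
lemma4 G H prime 3≤∣H∣ (φ , φ-injective , φ-adj) x x' twins with ∃-≢₂ 3≤∣H∣ x x'
... | _ , w₀≢x , w₀≢x' =
  Substitution.rerouting G H φ φ-injective φ-adj x x' (twins⇒≢ H twins) (twins⇒adj≡ H twins)
    prime w₀≢x w₀≢x'
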